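{- Let $N$ be a finite ground set and let $f\colon 2^N\to\mathbb{R}_{\ge0}$ be non-negative, submodular, and $p$-superseparable over $N$. Then for every $U\subseteq N$ and every $A\subseteq N$, $$\sum_{x\in U}f(x\mid A)\ \ge\ \sum_{x\in U}f(x)-p\,f(A).$$
   Context: Notation: $f(A\mid B)=f(A\cup B)-f(B)$, $f(x)=f(\{x\})$, $f(x\mid B)=f(\{x\}\mid B)$. Submodular: $f(x\mid A)\ge f(x\mid B)$ whenever $A\subseteq B\subseteq N$, $x\in N\setminus B$. $f$ is $p$-superseparable if for all $A\subseteq N$: $\sum_{x\in N}f(x\mid A)\ge\sum_{x\in N}f(x)-p\,f(A)$. -}

module Defs where

open import Level using (Level; _⊔_) renaming (suc to lsuc)
open import Data.Nat using (ℕ; zero; suc)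
open import Data.Fin using (Fin) renaming (zero to fzero; suc to fsuc)
open import Data.Fin.Subset using (Subset; ⁅_⁆; _∪_; _⊆_; _∉_)
open import Data.Bool using (Bool; true; false)
open import Data.Vec using ([]; _∷_; replicate)
open import Algebra.Bundles using (CommutativeRing)
open import Relation.Binary.Core using (Rel)
open import Relation.Binary.Structures using (IsTotalOrder)

-- A (totally) ordered commutative ring: the real numbers ℝ are an instance.
record OrderedCommRing (c ℓ₁ ℓ₂ : Level) : Set (lsuc (c ⊔ ℓ₁ ⊔ ℓ₂)) where
  field
    commutativeRing : CommutativeRing c ℓ₁
  open CommutativeRing commutativeRing public
  infix 4 _≤_
  field
    _≤_          : Rel Carrier ℓ₂
    isTotalOrder : IsTotalOrder _≈_ _≤_
    +-monoˡ-≤    : ∀ {a b} (d : Carrier) → a ≤ b → a + d ≤ b + d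
    *-nonneg     : ∀ {a b} → 0# ≤ a → 0# ≤ b → 0# ≤ a * b

module _ {c ℓ₁ ℓ₂} (R : OrderedCommRing c ℓ₁ ℓ₂) where
  open OrderedCommRing R

  sumOver : ∀ {n} → Subset n → (Fin n → Carrier) → Carrier
  sumOver {zero}  []           g = 0#
  sumOver {suc n} (true  ∷ U) g = g fzero + sumOver U (λ i → g (fsuc i))
  sumOver {suc n} (false ∷ U) g = sumOver U (λ i → g (fsuc i))

  ground : ∀ n → Subset n
  ground n = replicate n true

  marg : ∀ {n} → (Subset n → Carrier) → Subset n → Subset n → Carrier
  marg f A B = f (A ∪ B) - f B

  NonNegative : ∀ {n} → (Subset n → Carrier) → Set ℓ₂
  NonNegative f = ∀ A → 0# ≤ f A

  Submodular : ∀ {n} → (Subset n → Carrier) → Set ℓ₂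
  Submodular {n} f = ∀ (A B : Subset n) (x : Fin n) → A ⊆ B → x ∉ B →
    marg f ⁅ x ⁆ B ≤ marg f ⁅ x ⁆ A

  Superseparable : ∀ {n} → Carrier → (Subset n → Carrier) → Set ℓ₂
  Superseparable {n} p f = ∀ (A : Subset n) →
    sumOver (ground n) (λ x → f ⁅ x ⁆) - p * f A
      ≤ sumOver (ground n) (λ x → marg f ⁅ x ⁆ A)

{-# OPTIONS --safe #-}
module Submission where

-- Superseparability at A bounds the sum over all of N.  Split that sum into the parts over U and
-- over its complement: on the complement f(x ∣ A) ≤ f(x) termwise (submodularity against ∅ if
-- x ∉ A; the gain is 0 ≤ f(x) if x ∈ A), so the complement parts cancel in the right direction.

open import Defs
open import Data.Nat using (ℕ)
open import Data.Fin using (Fin) renaming (zero to fzero; suc to fsuc)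
open import Data.Fin.Subset using (Subset; ⁅_⁆; _∪_; ∁; ⊥; _∈_; inside; outside)
open import Data.Fin.Subset.Properties using (_∈?_; ⊥⊆; ∪-identityˡ; ∪-identityʳ)
open import Data.Vec using ([]; _∷_; here; there)
open import Relation.Nullary using (yes; no)
open import Relation.Binary.PropositionalEquality using (_≡_; cong)
open import Relation.Binary.Bundles using (Poset)
open import Relation.Binary.Structures using (IsTotalOrder)
import Relation.Binary.Reasoning.PartialOrder as PosetReasoning
import Algebra.Properties.Ring as RingProperties
import Algebra.Properties.CommutativeSemigroup as CommutativeSemigroupProperties

x∈p⇒⁅x⁆∪p≡p : ∀ {n} (x : Fin n) (p : Subset n) → x ∈ p → ⁅ x ⁆ ∪ p ≡ p
x∈p⇒⁅x⁆∪p≡p fzero    (inside ∷ p) here       = cong (inside ∷_) (∪-identityˡ p)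
x∈p⇒⁅x⁆∪p≡p (fsuc x) (b ∷ p)      (there x∈p) = cong (b ∷_) (x∈p⇒⁅x⁆∪p≡p x p x∈p)

module _ {c ℓ₁ ℓ₂} (R : OrderedCommRing c ℓ₁ ℓ₂) where
  open OrderedCommRing R
  open IsTotalOrder isTotalOrder using (isPartialOrder) renaming (refl to ≤-refl)
  open RingProperties ring using (//-rightDividesˡ; //-rightDividesʳ)
  open CommutativeSemigroupProperties +-commutativeSemigroup using (x∙yz≈y∙xz)

  ≤-poset : Poset c ℓ₁ ℓ₂
  ≤-poset = record { isPartialOrder = isPartialOrder }

  open PosetReasoning ≤-poset

  +-mono-≤ : ∀ {a b x y} → a ≤ b → x ≤ y → a + x ≤ b + y
  +-mono-≤ {a} {b} {x} {y} a≤b x≤y = begin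
    a + x ≤⟨ +-monoˡ-≤ x a≤b ⟩
    b + x ≈⟨ +-comm b x ⟩
    x + b ≤⟨ +-monoˡ-≤ b x≤y ⟩
    y + b ≈⟨ +-comm y b ⟩
    b + y ∎

  x-y≤x : ∀ x {y} → 0# ≤ y → x - y ≤ x
  x-y≤x x {y} 0≤y = begin
    x - y        ≈⟨ +-identityˡ (x - y) ⟨
    0# + (x - y) ≤⟨ +-monoˡ-≤ (x - y) 0≤y ⟩
    y + (x - y)  ≈⟨ +-comm y (x - y) ⟩
    x - y + y    ≈⟨ //-rightDividesˡ y x ⟩
    x            ∎

  x+z≤y+w∧w≤z⇒x≤y : ∀ {x y z w} → x + z ≤ y + w → w ≤ z → x ≤ y
  x+z≤y+w∧w≤z⇒x≤y {x} {y} {z} {w} x+z≤y+w w≤z = begin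
    x         ≈⟨ //-rightDividesʳ z x ⟨
    x + z - z ≤⟨ +-monoˡ-≤ (- z) x+z≤y+w ⟩
    y + w - z ≤⟨ +-monoˡ-≤ (- z) (+-mono-≤ ≤-refl w≤z) ⟩
    y + z - z ≈⟨ //-rightDividesʳ z y ⟩
    y         ∎

  sumOver-mono-≤ : ∀ {n} (U : Subset n) {g h : Fin n → Carrier} →
                   (∀ x → g x ≤ h x) → sumOver R U g ≤ sumOver R U h
  sumOver-mono-≤ []            g≤h = ≤-refl
  sumOver-mono-≤ (inside ∷ U)  g≤h = +-mono-≤ (g≤h fzero) (sumOver-mono-≤ U (λ i → g≤h (fsuc i)))
  sumOver-mono-≤ (outside ∷ U) g≤h = sumOver-mono-≤ U (λ i → g≤h (fsuc i))

  sumOver-ground≈sumOver+sumOver∁ : ∀ {n} (U : Subset n) (g : Fin n → Carrier) →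
    sumOver R (ground R n) g ≈ sumOver R U g + sumOver R (∁ U) g
  sumOver-ground≈sumOver+sumOver∁ []            g = sym (+-identityʳ 0#)
  sumOver-ground≈sumOver+sumOver∁ (inside ∷ U)  g = trans
    (+-congˡ (sumOver-ground≈sumOver+sumOver∁ U (λ i → g (fsuc i))))
    (sym (+-assoc _ _ _))
  sumOver-ground≈sumOver+sumOver∁ (outside ∷ U) g = trans
    (+-congˡ (sumOver-ground≈sumOver+sumOver∁ U (λ i → g (fsuc i))))
    (x∙yz≈y∙xz _ _ _)

  marg-⁅x⁆≤f⁅x⁆ : ∀ {n} {f : Subset n → Carrier} → NonNegative R f → Submodular R f →
                  ∀ A x → marg R f ⁅ x ⁆ A ≤ f ⁅ x ⁆
  marg-⁅x⁆≤f⁅x⁆ {f = f} f≥0 f-submod A x with x ∈? A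
  ... | yes x∈A = begin
    f (⁅ x ⁆ ∪ A) - f A ≡⟨ cong (λ S → f S - f A) (x∈p⇒⁅x⁆∪p≡p x A x∈A) ⟩
    f A - f A           ≈⟨ -‿inverseʳ (f A) ⟩
    0#                  ≤⟨ f≥0 ⁅ x ⁆ ⟩
    f ⁅ x ⁆             ∎
  ... | no x∉A = begin
    marg R f ⁅ x ⁆ A    ≤⟨ f-submod ⊥ A x ⊥⊆ x∉A ⟩
    f (⁅ x ⁆ ∪ ⊥) - f ⊥ ≡⟨ cong (λ S → f S - f ⊥) (∪-identityʳ ⁅ x ⁆) ⟩
    f ⁅ x ⁆ - f ⊥       ≤⟨ x-y≤x (f ⁅ x ⁆) (f≥0 ⊥) ⟩
    f ⁅ x ⁆             ∎

lemma2 : ∀ {c ℓ₁ ℓ₂} (R : OrderedCommRing c ℓ₁ ℓ₂) (n : ℕ)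
           (f : Subset n → OrderedCommRing.Carrier R) (p : OrderedCommRing.Carrier R) →
           NonNegative R f → Submodular R f → Superseparable R p f →
           ∀ (U A : Subset n) →
           OrderedCommRing._≤_ R
             (OrderedCommRing._-_ R (sumOver R U (λ x → f ⁅ x ⁆)) (OrderedCommRing._*_ R p (f A)))
             (sumOver R U (λ x → marg R f ⁅ x ⁆ A))
lemma2 R n f p f≥0 f-submod f-supersep U A =
  x+z≤y+w∧w≤z⇒x≤y R superseparable-split
    (sumOver-mono-≤ R (∁ U) (marg-⁅x⁆≤f⁅x⁆ R f≥0 f-submod A))
  where
  open OrderedCommRing R
  open PosetReasoning (≤-poset R)
  open CommutativeSemigroupProperties +-commutativeSemigroup using (xy∙z≈xz∙y)
  g h : Fin n → Carrier
  g x = f ⁅ x ⁆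
  h x = marg R f ⁅ x ⁆ A
  superseparable-split : sumOver R U g - p * f A + sumOver R (∁ U) g ≤ sumOver R U h + sumOver R (∁ U) h
  superseparable-split = begin
    sumOver R U g - p * f A + sumOver R (∁ U) g   ≈⟨ xy∙z≈xz∙y _ _ _ ⟩
    sumOver R U g + sumOver R (∁ U) g - p * f A   ≈⟨ +-congʳ (sumOver-ground≈sumOver+sumOver∁ R U g) ⟨
    sumOver R (ground R n) g - p * f A            ≤⟨ f-supersep A ⟩
    sumOver R (ground R n) h                      ≈⟨ sumOver-ground≈sumOver+sumOver∁ R U h ⟩
    sumOver R U h + sumOver R (∁ U) h             ∎
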